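{- Let $\Sigma$ be a signed alphabet and let $u=x_1\ldots x_p$ and $v=y_1\ldots y_q$ be super columns over $\Sigma$ such that the topmost juxtaposition of $[u]_r$ and $[v]_r$ does not form a super tableau, i.e. either $p<q$, or there is some $i\le q$ with $x_i\ge y_i$, where $x_i=y_i$ is allowed only if $\|x_i\|=1$. Then the super tableau $[uv]_r$ has at most two columns. Moreover, if $[uv]_r$ has exactly two columns, then its left column contains more entries than $u$, i.e. more than $p$ entries.
   Context: A signed alphabet is a finite or countable totally ordered set $\Sigma$ together with a map $\|\cdot\|:\Sigma\to\mathbb{Z}_2=\{0,1\}$. Write $\Sigma_0=\{a:\|a\|=0\}$ and $\Sigma_1=\{a:\|a\|=1\}$. A super row is a word $x_1\ldots x_k$ over $\Sigma$ with $x_i\le x_{i+1}$ for all $i$, where $x_i=x_{i+1}$ is allowed only if $\|x_i\|=0$. A super column is a word $x_1\ldots x_k$ over $\Sigma$ with $x_{i+1}\le x_i$ for all $i$, where $x_i=x_{i+1}$ is allowed only if $\|x_i\|=1$. A super tableau over $\Sigma$ is a filling $T$ of a Young diagram (left-justified rows of weakly decreasing lengths, top to bottom) by elements of $\Sigma$ satisfying two conditions: - $T(i,j)\le T(i,j+1)$, with equality only if $\|T(i,j)\|=0$; - $T(i,j)\le T(i+1,j)$, with equality only if $\|T(i,j)\|=1$. The reading of a column of a super tableau lists its entries from bottom to top, which yields a super column. A one-column super tableau is identified with its reading. The right insertion $t\leftarrow x$ of $x\in\Sigma$ into a super tableau $t$ works as follows. - If $x\in\Sigma_0$ (resp. $x\in\Sigma_1$)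 is at least as large as (resp. strictly larger than) the last entry of the top row, append $x$ at the end of that row. - Otherwise, let $y$ be the smallest entry of the top row with $y>x$ (resp. $y\ge x$). Then $x$ replaces $y$, and $y$ is bumped into the next row, where the process repeats. - When a bumped element can be appended at the end of a row (or a new row is reached), it is placed there. For a word $w=x_1\ldots x_k$ over $\Sigma$, $[w]_r=((\emptyset\leftarrow x_1)\leftarrow\cdots)\leftarrow x_k$, starting from the empty tableau. For super columns $u,v$, the topmost juxtaposition of $[u]_r$ and $[v]_r$ forms a super tableau iff $|u|\ge|v|$ and $x_i\le y_i$ for all $i\le |v|$, with $x_i=y_i$ only if $\|x_i\|=0$. -}

module Defs where

open import Data.Nat using (ℕ; _<_)
open import Data.Bool using (Bool; true; false; if_then_else_)
open import Data.List using (List; []; _∷_; length; reverse; zip; _++_; [_])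
open import Data.List.Relation.Unary.Any using (Any)
open import Data.List.Relation.Unary.Linked using (Linked)
open import Data.Maybe using (Maybe; just; nothing)
open import Data.Product using (_×_; _,_; Σ; ∃)
open import Data.Sum using (_⊎_)
open import Relation.Binary.PropositionalEquality using (_≡_)
open import Relation.Binary.Structures using (IsStrictTotalOrder)
open import Relation.Binary.Definitions using (tri<; tri≈; tri>)
open import Function.Definitions using (Injective)

-- A signed alphabet: a finite or countable (injects into ℕ) totally ordered
-- set with a parity map ‖_‖ : Σ → ℤ₂, where ℤ₂ is encoded as Bool
-- (false = 0, true = 1).
record SignedAlphabet : Set₁ where
  field
    Carrier   : Set
    _<ₛ_      : Carrier → Carrier → Set
    isSTO     : IsStrictTotalOrder _≡_ _<ₛ_
    ‖_‖       : Carrier → Bool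
    enc       : Carrier → ℕ
    enc-inj   : Injective _≡_ _≡_ enc

module _ (S : SignedAlphabet) where
  open SignedAlphabet S
  open IsStrictTotalOrder isSTO using (compare)

  ColStep : Carrier → Carrier → Set
  ColStep a b = (b <ₛ a) ⊎ (b ≡ a × ‖ a ‖ ≡ true)

  IsSuperColumn : List Carrier → Set
  IsSuperColumn = Linked ColStep

  -- A (super) tableau is represented as its list of rows, top row first.
  Tableau : Set
  Tableau = List (List Carrier)

  bumps : Carrier → Carrier → Bool
  bumps x y with compare x y | ‖ x ‖
  ... | tri< _ _ _ | _     = true
  ... | tri≈ _ _ _ | true  = true
  ... | tri≈ _ _ _ | false = false
  ... | tri> _ _ _ | _     = false

  -- insert x into a row: the leftmost (= smallest, rows being super rows)
  -- entry y that x bumps is replaced by x and returned; otherwise x is appended.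
  rowInsert : Carrier → List Carrier → List Carrier × Maybe Carrier
  rowInsert x [] = [ x ] , nothing
  rowInsert x (y ∷ ys) with bumps x y
  ... | true  = (x ∷ ys) , just y
  ... | false with rowInsert x ys
  ...   | r , m = (y ∷ r) , m

  insert : Tableau → Carrier → Tableau
  insert [] x = [ [ x ] ]
  insert (r ∷ rs) x with rowInsert x r
  ... | r' , nothing = r' ∷ rs
  ... | r' , just y  = r' ∷ insert rs y

  insertWord : Tableau → List Carrier → Tableau
  insertWord t [] = t
  insertWord t (x ∷ xs) = insertWord (insert t x) xs

  [_]ᵣ : List Carrier → Tableau
  [ w ]ᵣ = insertWord [] w

  numColumns : Tableau → ℕ
  numColumns [] = 0
  numColumns (r ∷ _) = length r

  leftColumnLength : Tableau → ℕ
  leftColumnLength = length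

  -- Failure of the row condition between the i-th entry a of the left
  -- column and the i-th entry b of the right column (counted from the top):
  -- a ≥ b, with a = b allowed only if ‖a‖ = 1.
  BadPair : Carrier × Carrier → Set
  BadPair (a , b) = (b <ₛ a) ⊎ (a ≡ b × ‖ a ‖ ≡ true)

  -- The column [u]_r of a super column u = x₁…x_p has x_p on top and x₁ at
  -- the bottom, so entries counted from the top are given by reverse u.
  NotJuxtaposable : List Carrier → List Carrier → Set
  NotJuxtaposable u v =
    length u < length v ⊎ Any BadPair (zip (reverse u) (reverse v))

{-# OPTIONS --safe #-}
-- When a super column u is inserted, every letter bumps the whole column built
-- so far, so [u]ᵣ is the single column reverse u.  Each letter of a super column bumps its predecessor, so each new
-- bumping path starts by bumping the first entry of the previous path and then
-- runs weakly to the left of it: the new boxes form a vertical strip over a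
-- single column, hence at most two columns.  As for the rows: as long as every
-- bumping path stays in the second column, the tableau is the topmost
-- juxtaposition of [u]ᵣ with the part of v inserted so far, which then
-- satisfies the row condition; once a path bumps into the left column, that
-- column is pushed down and [uv]ᵣ has more than |u| rows.
module Submission where

open import Defs
open import Data.Bool using (true; false)
open import Data.List using (List; []; _∷_; _++_; [_]; length; map; head; reverse; zip; _ʳ++_)
open import Data.List.Properties using (length-reverse)
open import Data.List.Membership.Propositional using (_∈_)
open import Data.List.Relation.Unary.All using (All; []; _∷_)
open import Data.List.Relation.Unary.Any using (Any; here; there)
open import Data.List.Relation.Unary.Linked using (Linked; []; _∷_; head′; tail; _∷′_)
open import Data.Maybe using (Maybe; just; nothing)
open import Data.Maybe.Relation.Binary.Connected as Connected using (Connected; just; just-nothing; nothing)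
open import Data.Nat using (suc; _≤_; _<_; z≤n; s≤s)
open import Data.Nat.Properties using (≤-refl; ≤-reflexive; ≤-trans; <⇒≱)
open import Data.Product using (_×_; _,_; proj₁; proj₂; ∃-syntax)
open import Data.Sum using (_⊎_; inj₁; inj₂)
open import Data.Empty using (⊥-elim)
open import Relation.Nullary using (¬_)
open import Relation.Binary.Definitions using (tri<; tri≈; tri>)
open import Relation.Binary.PropositionalEquality using (_≡_; refl; sym; trans; cong)
open import Relation.Binary.Structures using (IsStrictTotalOrder)

module _ (S : SignedAlphabet) where
  open SignedAlphabet S
  open IsStrictTotalOrder isSTO using (compare; irrefl) renaming (trans to <-trans)

  infix 4 _⊳_ _⋫_

  _⊳_ _⋫_ : Carrier → Carrier → Set
  x ⊳ y = bumps S x y ≡ true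
  x ⋫ y = bumps S x y ≡ false

  ⊳-or-⋫ : ∀ x y → x ⊳ y ⊎ x ⋫ y
  ⊳-or-⋫ x y with bumps S x y
  ... | true  = inj₁ refl
  ... | false = inj₂ refl

  ⊳⇒¬⋫ : ∀ {x y} → x ⊳ y → ¬ x ⋫ y
  ⊳⇒¬⋫ p q with () ← trans (sym p) q

  ⊳⇒≤ : ∀ {x y} → x ⊳ y → x <ₛ y ⊎ (x ≡ y × ‖ x ‖ ≡ true)
  ⊳⇒≤ {x} {y} p with compare x y | ‖ x ‖
  ... | tri< x<y _ _ | _     = inj₁ x<y
  ... | tri≈ _ x≡y _ | true  = inj₂ (x≡y , refl)
  ... | tri≈ _ _ _   | false with () ← p
  ... | tri> _ _ _   | _     with () ← p

  ⋫⇒≥ : ∀ {x y} → x ⋫ y → y <ₛ x ⊎ (x ≡ y × ‖ x ‖ ≡ false)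
  ⋫⇒≥ {x} {y} p with compare x y | ‖ x ‖
  ... | tri< _ _ _   | _     with () ← p
  ... | tri≈ _ _ _   | true  with () ← p
  ... | tri≈ _ x≡y _ | false = inj₂ (x≡y , refl)
  ... | tri> _ _ y<x | _     = inj₁ y<x

  <⇒⊳ : ∀ {x y} → x <ₛ y → x ⊳ y
  <⇒⊳ {x} {y} x<y with compare x y | ‖ x ‖
  ... | tri< _ _ _    | _ = refl
  ... | tri≈ _ x≡y _  | _ = ⊥-elim (irrefl x≡y x<y)
  ... | tri> x≮y _ _  | _ = ⊥-elim (x≮y x<y)

  >⇒⋫ : ∀ {x y} → y <ₛ x → x ⋫ y
  >⇒⋫ {x} {y} y<x with compare x y | ‖ x ‖
  ... | tri< _ _ y≮x  | _ = ⊥-elim (y≮x y<x)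
  ... | tri≈ _ x≡y _  | _ = ⊥-elim (irrefl (sym x≡y) y<x)
  ... | tri> _ _ _    | _ = refl

  bumps-self : ∀ x → bumps S x x ≡ ‖ x ‖
  bumps-self x with compare x x | ‖ x ‖
  ... | tri< x<x _ _ | _     = ⊥-elim (irrefl refl x<x)
  ... | tri≈ _ _ _   | true  = refl
  ... | tri≈ _ _ _   | false = refl
  ... | tri> _ _ x>x | _     = ⊥-elim (irrefl refl x>x)

  ⋫∧⊳⇒⊳ : ∀ {a c d} → c ⋫ a → c ⊳ d → a ⊳ d
  ⋫∧⊳⇒⊳ c⋫a c⊳d with ⋫⇒≥ c⋫a | ⊳⇒≤ c⊳d
  ... | inj₁ a<c        | inj₁ c<d        = <⇒⊳ (<-trans a<c c<d)
  ... | inj₁ a<c        | inj₂ (refl , _) = <⇒⊳ a<c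
  ... | inj₂ (refl , _) | inj₁ c<d        = <⇒⊳ c<d
  ... | inj₂ (refl , _) | inj₂ (refl , _) = ⊥-elim (⊳⇒¬⋫ c⊳d c⋫a)

  ⋫∧⊳⇒⊳-head : ∀ {a c m} → c ⋫ a → Connected _⊳_ (just c) m → Connected _⊳_ (just a) m
  ⋫∧⊳⇒⊳-head c⋫a (just c⊳d)  = just (⋫∧⊳⇒⊳ c⋫a c⊳d)
  ⋫∧⊳⇒⊳-head c⋫a just-nothing = just-nothing

  ⊳∧⋫⇒⋫ : ∀ {x a b} → x ⊳ a → b ⋫ a → b ⋫ x
  ⊳∧⋫⇒⋫ x⊳a b⋫a with ⊳⇒≤ x⊳a | ⋫⇒≥ b⋫a
  ... | inj₁ x<a        | inj₁ a<b        = >⇒⋫ (<-trans x<a a<b)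
  ... | inj₁ x<a        | inj₂ (refl , _) = >⇒⋫ x<a
  ... | inj₂ (refl , _) | inj₁ a<b        = >⇒⋫ a<b
  ... | inj₂ (refl , _) | inj₂ (refl , _) = ⊥-elim (⊳⇒¬⋫ x⊳a b⋫a)

  colStep⇒⊳ : ∀ {a b} → ColStep S a b → b ⊳ a
  colStep⇒⊳ (inj₁ b<a)          = <⇒⊳ b<a
  colStep⇒⊳ (inj₂ (refl , odd)) = trans (bumps-self _) odd

  badPair⇒⊳ : ∀ {a b} → BadPair S (a , b) → b ⊳ a
  badPair⇒⊳ (inj₁ b<a)          = <⇒⊳ b<a
  badPair⇒⊳ (inj₂ (refl , odd)) = trans (bumps-self _) odd

  ⊳-nothing : ∀ {m : Maybe Carrier} → Connected _⊳_ m nothing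
  ⊳-nothing {just _}  = just-nothing
  ⊳-nothing {nothing} = nothing

  insert-bump-first : ∀ {z a r T} → z ⊳ a →
                      insert S ((a ∷ r) ∷ T) z ≡ (z ∷ r) ∷ insert S T a
  insert-bump-first z⊳a rewrite z⊳a = refl

  insert-bump-second : ∀ {z a b r T} → z ⋫ a → z ⊳ b →
                       insert S ((a ∷ b ∷ r) ∷ T) z ≡ (a ∷ z ∷ r) ∷ insert S T b
  insert-bump-second z⋫a z⊳b rewrite z⋫a | z⊳b = refl

  insert-append-second : ∀ {z a T} → z ⋫ a →
                         insert S ((a ∷ []) ∷ T) z ≡ (a ∷ z ∷ []) ∷ T
  insert-append-second z⋫a rewrite z⋫a = refl

  insertWord-++ : ∀ T xs ys → insertWord S T (xs ++ ys) ≡ insertWord S (insertWord S T xs) ys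
  insertWord-++ T []       ys = refl
  insertWord-++ T (x ∷ xs) ys = insertWord-++ (insert S T x) xs ys

  length≤length-insert : ∀ T x → length T ≤ length (insert S T x)
  length≤length-insert []       x = z≤n
  length≤length-insert (r ∷ rs) x with rowInsert S x r
  ... | _ , nothing = ≤-refl
  ... | _ , just y  = s≤s (length≤length-insert rs y)

  column : List Carrier → Tableau S
  column = map [_]

  -- Read top-down, a column of a super tableau is exactly a ⊳-chain.
  IsColumn : List Carrier → Set
  IsColumn = Linked _⊳_

  insert-column : ∀ {x U} → IsColumn (x ∷ U) → insert S (column U) x ≡ column (x ∷ U)
  insert-column {U = []}    _             = refl
  insert-column {U = a ∷ U} (x⊳a ∷ colU) rewrite insert-bump-first {r = []} {T = column U} x⊳a =
    cong ([ _ ] ∷_) (insert-column colU)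

  superColumn-head : ∀ {x xs} → IsSuperColumn S (x ∷ xs) → Connected _⊳_ (head xs) (just x)
  superColumn-head lk = Connected.sym colStep⇒⊳ (head′ lk)

  StacksOn : List Carrier → List Carrier → Set
  StacksOn xs U = IsColumn U × IsSuperColumn S xs × Connected _⊳_ (head xs) (head U)

  stacksOn-[] : ∀ {xs} → IsSuperColumn S xs → StacksOn xs []
  stacksOn-[] lk = [] , lk , ⊳-nothing

  stacksOn-∷ : ∀ {x xs U} → StacksOn (x ∷ xs) U → StacksOn xs (x ∷ U)
  stacksOn-∷ (colU , lk , x⊳U) = x⊳U ∷′ colU , tail lk , superColumn-head lk

  stacksOn⇒isColumn : ∀ xs {U} → StacksOn xs U → IsColumn (xs ʳ++ U)
  stacksOn⇒isColumn []       (colU , _) = colU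
  stacksOn⇒isColumn (x ∷ xs) s          = stacksOn⇒isColumn xs (stacksOn-∷ s)

  insertWord-column : ∀ xs {U} → StacksOn xs U → insertWord S (column U) xs ≡ column (xs ʳ++ U)
  insertWord-column []       _ = refl
  insertWord-column (x ∷ xs) s rewrite insert-column (proj₁ (stacksOn-∷ s)) =
    insertWord-column xs (stacksOn-∷ s)

  [superColumn]ᵣ : ∀ {u} → IsSuperColumn S u → [_]ᵣ S u ≡ column (reverse u)
  [superColumn]ᵣ {u} cu = insertWord-column u (stacksOn-[] cu)

  data NarrowRow : List Carrier → Set where
    single : ∀ a → NarrowRow (a ∷ [])
    pair   : ∀ {a b} → b ⋫ a → NarrowRow (a ∷ b ∷ [])

  -- cs lists, row by row, the entries placed by the last insertion into T.
  data BumpPath : Tableau S → List Carrier → Set where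
    column⁺ : ∀ U → BumpPath (column U) []
    row     : ∀ {r T c cs} → NarrowRow r → c ∈ r → Connected _⊳_ (just c) (head cs) →
              BumpPath T cs → BumpPath (r ∷ T) (c ∷ cs)

  bumpPath⇒numColumns≤2 : ∀ {T cs} → BumpPath T cs → numColumns S T ≤ 2
  bumpPath⇒numColumns≤2 (column⁺ [])      = z≤n
  bumpPath⇒numColumns≤2 (column⁺ (_ ∷ _)) = s≤s z≤n
  bumpPath⇒numColumns≤2 (row (single _) _ _ _) = s≤s z≤n
  bumpPath⇒numColumns≤2 (row (pair _) _ _ _)   = s≤s (s≤s z≤n)

  insert-column-bumpPath : ∀ z U → ∃[ cs ] BumpPath (insert S (column U) z) (z ∷ cs)
  insert-column-bumpPath z [] = [] , row (single z) (here refl) just-nothing (column⁺ [])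
  insert-column-bumpPath z (a ∷ U) with ⊳-or-⋫ z a
  ... | inj₁ z⊳a rewrite insert-bump-first {r = []} {T = column U} z⊳a
    with cs , p ← insert-column-bumpPath a U =
    a ∷ cs , row (single z) (here refl) (just z⊳a) p
  ... | inj₂ z⋫a rewrite insert-append-second {T = column U} z⋫a =
    [] , row (pair z⋫a) (there (here refl)) just-nothing (column⁺ U)

  -- A letter bumping the top of the last path inserts weakly to its left in every row.
  insert-bumpPath : ∀ {T cs} z → BumpPath T cs → Connected _⊳_ (just z) (head cs) →
                    ∃[ cs′ ] BumpPath (insert S T z) (z ∷ cs′)
  insert-bumpPath z (column⁺ U) _ = insert-column-bumpPath z U
  insert-bumpPath z (row {T = T} (single a) (here refl) a⊳cs p) (just z⊳a)
    rewrite insert-bump-first {r = []} {T = T} z⊳a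
    with cs′ , p′ ← insert-bumpPath a p a⊳cs =
    a ∷ cs′ , row (single z) (here refl) (just z⊳a) p′
  insert-bumpPath z (row {T = T} (pair {a} {b} b⋫a) (here refl) a⊳cs p) (just z⊳a)
    rewrite insert-bump-first {r = b ∷ []} {T = T} z⊳a
    with cs′ , p′ ← insert-bumpPath a p a⊳cs =
    a ∷ cs′ , row (pair (⊳∧⋫⇒⋫ z⊳a b⋫a)) (here refl) (just z⊳a) p′
  insert-bumpPath z (row {T = T} (pair {a} {b} b⋫a) (there (here refl)) b⊳cs p) (just z⊳b)
    with ⊳-or-⋫ z a
  ... | inj₁ z⊳a rewrite insert-bump-first {r = b ∷ []} {T = T} z⊳a
    with cs′ , p′ ← insert-bumpPath a p (⋫∧⊳⇒⊳-head b⋫a b⊳cs) =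
    a ∷ cs′ , row (pair (⊳∧⋫⇒⋫ z⊳a b⋫a)) (here refl) (just z⊳a) p′
  ... | inj₂ z⋫a rewrite insert-bump-second {r = []} {T = T} z⋫a z⊳b
    with cs′ , p′ ← insert-bumpPath b p b⊳cs =
    b ∷ cs′ , row (pair z⋫a) (there (here refl)) (just z⊳b) p′

  insertWord-bumpPath : ∀ {T cs} ys → BumpPath T cs → IsSuperColumn S ys →
                        Connected _⊳_ (head ys) (head cs) → ∃[ cs′ ] BumpPath (insertWord S T ys) cs′
  insertWord-bumpPath []       p _  _    = _ , p
  insertWord-bumpPath (y ∷ ys) p lk y⊳cs with cs′ , p′ ← insert-bumpPath y p y⊳cs =
    insertWord-bumpPath ys p′ (tail lk) (superColumn-head lk)

  numColumns-insertWord-superColumn : ∀ U {v} → IsSuperColumn S v →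
                                      numColumns S (insertWord S (column U) v) ≤ 2
  numColumns-insertWord-superColumn U {v} cv
    with _ , p ← insertWord-bumpPath v (column⁺ U) cv ⊳-nothing = bumpPath⇒numColumns≤2 p

  juxtapose : List Carrier → List Carrier → Tableau S
  juxtapose []      _       = []
  juxtapose (a ∷ U) []      = (a ∷ []) ∷ juxtapose U []
  juxtapose (a ∷ U) (b ∷ W) = (a ∷ b ∷ []) ∷ juxtapose U W

  juxtapose-[] : ∀ U → juxtapose U [] ≡ column U
  juxtapose-[] []      = refl
  juxtapose-[] (a ∷ U) = cong ([ a ] ∷_) (juxtapose-[] U)

  Juxtaposable : List Carrier → List Carrier → Set
  Juxtaposable U W = length W ≤ length U × All (λ (a , b) → b ⋫ a) (zip U W)

  juxtaposable-[] : ∀ U → Juxtaposable U []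
  juxtaposable-[] []      = z≤n , []
  juxtaposable-[] (_ ∷ _) = z≤n , []

  juxtaposable⇒¬notJuxtaposable : ∀ {u v} → Juxtaposable (reverse u) (reverse v) →
                                  ¬ NotJuxtaposable S u v
  juxtaposable⇒¬notJuxtaposable {u} {v} (|v|≤|u| , _) (inj₁ |u|<|v|)
    rewrite length-reverse u | length-reverse v = <⇒≱ |u|<|v| |v|≤|u|
  juxtaposable⇒¬notJuxtaposable (_ , rowsOk) (inj₂ bad) = allOk⇒¬bad rowsOk bad
    where
      allOk⇒¬bad : ∀ {ps} → All (λ (a , b) → b ⋫ a) ps → ¬ Any (BadPair S) ps
      allOk⇒¬bad (b⋫a ∷ _)  (here ab-bad) = ⊳⇒¬⋫ (badPair⇒⊳ ab-bad) b⋫a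
      allOk⇒¬bad (_ ∷ oks) (there bad′)  = allOk⇒¬bad oks bad′

  length-insert-juxtapose-bumpTop : ∀ {x U} W → IsColumn (x ∷ U) →
                                    length (insert S (juxtapose U W) x) ≡ suc (length U)
  length-insert-juxtapose-bumpTop {U = []}    _       _ = refl
  length-insert-juxtapose-bumpTop {U = a ∷ U} []      (x⊳a ∷ colU)
    rewrite insert-bump-first {r = []} {T = juxtapose U []} x⊳a =
    cong suc (length-insert-juxtapose-bumpTop [] colU)
  length-insert-juxtapose-bumpTop {U = a ∷ U} (b ∷ W) (x⊳a ∷ colU)
    rewrite insert-bump-first {r = b ∷ []} {T = juxtapose U W} x⊳a =
    cong suc (length-insert-juxtapose-bumpTop W colU)

  LongerOrJuxtaposed : List Carrier → List Carrier → Tableau S → Set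
  LongerOrJuxtaposed U W T = length U < length T ⊎ (T ≡ juxtapose U W × Juxtaposable U W)

  insert-juxtapose : ∀ {y} U W → IsColumn U → IsColumn (y ∷ W) →
                     LongerOrJuxtaposed U (y ∷ W) (insert S (juxtapose U W) y)
  insert-juxtapose []      _ _ _ = inj₁ (s≤s z≤n)
  insert-juxtapose {y} (a ∷ U) [] colaU _ with ⊳-or-⋫ y a
  ... | inj₁ y⊳a = inj₁ (≤-reflexive (sym (length-insert-juxtapose-bumpTop [] (y⊳a ∷ colaU))))
  ... | inj₂ y⋫a rewrite insert-append-second {T = juxtapose U []} y⋫a =
    inj₂ (refl , s≤s z≤n , y⋫a ∷ proj₂ (juxtaposable-[] U))
  insert-juxtapose {y} (a ∷ U) (b ∷ W) colaU (y⊳b ∷ colbW) with ⊳-or-⋫ y a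
  ... | inj₁ y⊳a = inj₁ (≤-reflexive (sym (length-insert-juxtapose-bumpTop (b ∷ W) (y⊳a ∷ colaU))))
  ... | inj₂ y⋫a rewrite insert-bump-second {r = []} {T = juxtapose U W} y⋫a y⊳b
    with insert-juxtapose U W (tail colaU) colbW
  ... | inj₁ longer               = inj₁ (s≤s longer)
  ... | inj₂ (eq , |W|≤|U| , oks) = inj₂ (cong ((a ∷ y ∷ []) ∷_) eq , s≤s |W|≤|U| , y⋫a ∷ oks)

  insertWord-juxtapose : ∀ {U W T} ys → IsColumn U → StacksOn ys W → LongerOrJuxtaposed U W T →
                         length U < length (insertWord S T ys) ⊎ Juxtaposable U (ys ʳ++ W)
  insertWord-juxtapose [] _ _ (inj₁ longer)       = inj₁ longer
  insertWord-juxtapose [] _ _ (inj₂ (_ , juxtU)) = inj₂ juxtU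
  insertWord-juxtapose {U} {W} {T} (y ∷ ys) colU s outcome =
    insertWord-juxtapose ys colU (stacksOn-∷ s) (insert-preserves outcome)
    where
      insert-preserves : LongerOrJuxtaposed U W T → LongerOrJuxtaposed U (y ∷ W) (insert S T y)
      insert-preserves (inj₁ longer)     = inj₁ (≤-trans longer (length≤length-insert T y))
      insert-preserves (inj₂ (refl , _)) = insert-juxtapose U W colU (proj₁ (stacksOn-∷ s))

  length<length-insertWord-superColumn : ∀ {u v} → IsSuperColumn S u → IsSuperColumn S v →
                                         NotJuxtaposable S u v →
                                         length u < length (insertWord S (column (reverse u)) v)
  length<length-insertWord-superColumn {u} {v} cu cv nj
    with insertWord-juxtapose v (stacksOn⇒isColumn u (stacksOn-[] cu)) (stacksOn-[] cv)
           (inj₂ (sym (juxtapose-[] (reverse u)) , juxtaposable-[] (reverse u)))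
  ... | inj₁ longer rewrite length-reverse u = longer
  ... | inj₂ juxt = ⊥-elim (juxtaposable⇒¬notJuxtaposable {u} {v} juxt nj)

lemma2p2 : (S : SignedAlphabet) (u v : List (SignedAlphabet.Carrier S)) →
           IsSuperColumn S u → IsSuperColumn S v →
           NotJuxtaposable S u v →
           numColumns S ([_]ᵣ S (u ++ v)) ≤ 2 ×
           (numColumns S ([_]ᵣ S (u ++ v)) ≡ 2 →
             length u < leftColumnLength S ([_]ᵣ S (u ++ v)))
lemma2p2 S u v cu cv nj rewrite insertWord-++ S [] u v | [superColumn]ᵣ S cu =
  numColumns-insertWord-superColumn S (reverse u) cv ,
  λ _ → length<length-insertWord-superColumn S cu cv nj
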